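{- For every finite set $\Gamma$ of formulas and finite multiset $\Delta$ of formulas: $(\Gamma;\Delta)\preceq_l(\cdot;\,!\Gamma,\Delta)$ and $(\cdot;\,!\Gamma,\Delta)\preceq_l(\Gamma;\Delta)$.
   Context: Formulas: $A,B,C ::= a \mid \mathbf{1} \mid A\otimes B \mid \top \mid A \,\&\, B \mid a \multimap B \mid\ !A$, with $a$ ranging over atomic formulas. Contexts $\Gamma,\Delta$ are finite multisets of formulas; "$\Delta_1,\Delta_2$" is multiset union, "$\cdot$" the empty context. $!\Gamma$ is the multiset obtained by prefixing every formula of $\Gamma$ with $!$. Sequents $\Gamma;\Delta\vdash A$ are derivable by the rules: (init) $\Gamma;a\vdash a$. (clone) from $\Gamma,A;\Delta,A\vdash C$ infer $\Gamma,A;\Delta\vdash C$. ($\otimes$R) from $\Gamma;\Delta_1\vdash A$ and $\Gamma;\Delta_2\vdash B$ infer $\Gamma;\Delta_1,\Delta_2\vdash A\otimes B$. ($\otimes$L) from $\Gamma;\Delta,A,B\vdash C$ infer $\Gamma;\Delta,A\otimes B\vdash C$. ($\mathbf 1$R) $\Gamma;\cdot\vdash\mathbf 1$. ($\mathbf 1$L) from $\Gamma;\Delta\vdash C$ infer $\Gamma;\Delta,\mathbf 1\vdash C$. ($\&$R) from $\Gamma;\Delta\vdash A$ and $\Gamma;\Delta\vdash B$ infer $\Gamma;\Delta\vdash A\&B$. ($\&$L$_i$, $i=1,2$) from $\Gamma;\Delta,A_i\vdash C$ infer $\Gamma;\Delta,A_1\&A_2\vdash C$. ($\top$R) $\Gamma;\Delta\vdash\top$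 (no left rule for $\top$). ($\multimap$R) from $\Gamma;\Delta,a\vdash B$ infer $\Gamma;\Delta\vdash a\multimap B$. ($\multimap$L) from $\Gamma;\Delta_1\vdash a$ and $\Gamma;\Delta_2,B\vdash C$ infer $\Gamma;\Delta_1,\Delta_2,a\multimap B\vdash C$. (!R) from $\Gamma;\cdot\vdash A$ infer $\Gamma;\cdot\vdash\,!A$. (!L) from $\Gamma,A;\Delta\vdash C$ infer $\Gamma;\Delta,!A\vdash C$. Logical preorder: $(\Gamma_1;\Delta_1)\preceq_l(\Gamma_2;\Delta_2)$ iff for all contexts $\Gamma',\Delta'$ and all formulas $C$, derivability of $\Gamma',\Gamma_1;\Delta',\Delta_1\vdash C$ implies derivability of $\Gamma',\Gamma_2;\Delta',\Delta_2\vdash C$. -}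

module Defs where

open import Data.Nat using (ℕ)
open import Data.List using (List; []; _∷_; _++_; map)
open import Data.Product using (_×_; _,_)
open import Data.List.Relation.Binary.Permutation.Propositional using (_↭_)

Atom : Set
Atom = ℕ

data Formula : Set where
  atom : Atom → Formula
  𝟏    : Formula
  _⊗_  : Formula → Formula → Formula
  ⊤'   : Formula
  _&_  : Formula → Formula → Formula
  _⊸_  : Atom → Formula → Formula
  !_   : Formula → Formula

-- Contexts: finite multisets, represented by lists taken up to permutation (_↭_).
Ctx : Set
Ctx = List Formula

!ctx : Ctx → Ctx
!ctx = map !_

-- Derivability of Γ ; Δ ⊢ C.  Every rule's conclusion is stated for
-- arbitrary lists that are permutations of the displayed contexts, so
-- derivability depends only on the underlying multisets.
data _⨾_⊢_ : Ctx → Ctx → Formula → Set where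
  init  : ∀ {Γ Δ a} → Δ ↭ (atom a ∷ []) → Γ ⨾ Δ ⊢ atom a
  clone : ∀ {Γ Γ₀ Δ A C} → Γ ↭ (A ∷ Γ₀) →
          Γ ⨾ (A ∷ Δ) ⊢ C → Γ ⨾ Δ ⊢ C
  ⊗R    : ∀ {Γ Δ Δ₁ Δ₂ A B} → Δ ↭ (Δ₁ ++ Δ₂) →
          Γ ⨾ Δ₁ ⊢ A → Γ ⨾ Δ₂ ⊢ B → Γ ⨾ Δ ⊢ (A ⊗ B)
  ⊗L    : ∀ {Γ Δ Δ₀ A B C} → Δ ↭ ((A ⊗ B) ∷ Δ₀) →
          Γ ⨾ (A ∷ B ∷ Δ₀) ⊢ C → Γ ⨾ Δ ⊢ C
  𝟏R    : ∀ {Γ Δ} → Δ ↭ [] → Γ ⨾ Δ ⊢ 𝟏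
  𝟏L    : ∀ {Γ Δ Δ₀ C} → Δ ↭ (𝟏 ∷ Δ₀) →
          Γ ⨾ Δ₀ ⊢ C → Γ ⨾ Δ ⊢ C
  &R    : ∀ {Γ Δ A B} → Γ ⨾ Δ ⊢ A → Γ ⨾ Δ ⊢ B → Γ ⨾ Δ ⊢ (A & B)
  &L₁   : ∀ {Γ Δ Δ₀ A B C} → Δ ↭ ((A & B) ∷ Δ₀) →
          Γ ⨾ (A ∷ Δ₀) ⊢ C → Γ ⨾ Δ ⊢ C
  &L₂   : ∀ {Γ Δ Δ₀ A B C} → Δ ↭ ((A & B) ∷ Δ₀) →
          Γ ⨾ (B ∷ Δ₀) ⊢ C → Γ ⨾ Δ ⊢ C
  ⊤R    : ∀ {Γ Δ} → Γ ⨾ Δ ⊢ ⊤'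
  ⊸R    : ∀ {Γ Δ a B} → Γ ⨾ (atom a ∷ Δ) ⊢ B → Γ ⨾ Δ ⊢ (a ⊸ B)
  ⊸L    : ∀ {Γ Δ Δ₁ Δ₂ a B C} → Δ ↭ ((a ⊸ B) ∷ Δ₁ ++ Δ₂) →
          Γ ⨾ Δ₁ ⊢ atom a → Γ ⨾ (B ∷ Δ₂) ⊢ C → Γ ⨾ Δ ⊢ C
  !R    : ∀ {Γ Δ A} → Δ ↭ [] → Γ ⨾ [] ⊢ A → Γ ⨾ Δ ⊢ (! A)
  !L    : ∀ {Γ Γ' Δ Δ₀ A C} → Δ ↭ ((! A) ∷ Δ₀) → Γ' ↭ (A ∷ Γ) →
          Γ' ⨾ Δ₀ ⊢ C → Γ ⨾ Δ ⊢ C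

_≼ₗ_ : Ctx × Ctx → Ctx × Ctx → Set
(Γ₁ , Δ₁) ≼ₗ (Γ₂ , Δ₂) =
  ∀ (Γ' Δ' : Ctx) (C : Formula) →
  (Γ' ++ Γ₁) ⨾ (Δ' ++ Δ₁) ⊢ C → (Γ' ++ Γ₂) ⨾ (Δ' ++ Δ₂) ⊢ C

-- A derivation can always apply !L to a banged formula in the linear context,
-- which moves its body into the unrestricted context; this gives the first
-- preorder.  Conversely, !L is invertible: a formula !A in the linear context
-- can only be principal in an !L step, whose premise already has A in the
-- unrestricted context, and every other rule commutes with the inversion.
-- Iterating over Γ gives the second preorder.
module Submission where

open import Defs
open import Data.List using ([]; _∷_; _++_; [_])
open import Data.List.Properties using (++-assoc; ++-identityʳ)
open import Data.Product using (_×_; _,_; proj₂; Σ-syntax)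
open import Data.Sum using (_⊎_; inj₁; inj₂)
open import Data.Empty using (⊥-elim)
open import Function using (_∘_)
open import Relation.Binary.PropositionalEquality using (_≡_; refl; sym; cong; subst)
open import Data.List.Membership.Propositional using (_∈_)
open import Data.List.Membership.Propositional.Properties using (∈-∃++; ∈-++⁻)
open import Data.List.Relation.Unary.Any using (here; there)
open import Data.List.Relation.Binary.Subset.Propositional using (_⊆_)
open import Data.List.Relation.Binary.Subset.Propositional.Properties
  using (⊆-reflexive-↭; ∷⁺ʳ; xs⊆x∷xs)
open import Data.List.Relation.Binary.Permutation.Propositional
open import Data.List.Relation.Binary.Permutation.Propositional.Properties
  using (∈-resp-↭; drop-∷; shift; ¬x∷xs↭[]; ++⁺ʳ; ++⁺ˡ; ++-comm)

∈⇒↭∷ : ∀ {x : Formula} {xs} → x ∈ xs → Σ[ ys ∈ Ctx ] xs ↭ x ∷ ys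
∈⇒↭∷ {x} x∈xs with ∈-∃++ x∈xs
... | ys , zs , refl = ys ++ zs , shift x ys zs

↭∷⇒∈ : ∀ {x : Formula} {xs ys} → xs ↭ x ∷ ys → x ∈ xs
↭∷⇒∈ xs↭ = ∈-resp-↭ (↭-sym xs↭) (here refl)

prep-swap : ∀ {x : Formula} {xs ys} y → xs ↭ x ∷ ys → y ∷ xs ↭ x ∷ y ∷ ys
prep-swap {x} y xs↭ = ↭-trans (prep y xs↭) (swap y x refl)

∷↭∷-cases : ∀ {x y : Formula} {xs ys} → x ∷ xs ↭ y ∷ ys →
  (x ≡ y × xs ↭ ys) ⊎ (Σ[ zs ∈ Ctx ] (xs ↭ y ∷ zs) × (ys ↭ x ∷ zs))
∷↭∷-cases {y = y} p with ∈-resp-↭ p (here refl)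
... | here refl = inj₁ (refl , drop-∷ p)
... | there x∈ys with ∈⇒↭∷ x∈ys
...   | zs , ys↭ = inj₂ (zs , drop-∷ (↭-trans p (prep-swap y ys↭)) , ys↭)

++↭∷-cases : ∀ {xs ys zs : Ctx} {y} → xs ++ ys ↭ y ∷ zs →
  (Σ[ ws ∈ Ctx ] (xs ↭ y ∷ ws) × (zs ↭ ws ++ ys)) ⊎
  (Σ[ ws ∈ Ctx ] (ys ↭ y ∷ ws) × (zs ↭ xs ++ ws))
++↭∷-cases {xs} {ys} {y = y} p with ∈-++⁻ xs (↭∷⇒∈ p)
... | inj₁ y∈xs with ∈⇒↭∷ y∈xs
...   | ws , xs↭ = inj₁ (ws , xs↭ , drop-∷ (↭-trans (↭-sym p) (++⁺ʳ ys xs↭)))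
++↭∷-cases {xs} {ys} {y = y} p | inj₂ y∈ys with ∈⇒↭∷ y∈ys
...   | ws , ys↭ =
  inj₂ (ws , ys↭ , drop-∷ (↭-trans (↭-sym p) (↭-trans (++⁺ˡ xs ys↭) (shift y xs ws))))

⊢-mono : ∀ {Γ₁ Γ₂ Δ₁ Δ₂ C} → Γ₁ ⊆ Γ₂ → Δ₁ ↭ Δ₂ → Γ₁ ⨾ Δ₁ ⊢ C → Γ₂ ⨾ Δ₂ ⊢ C
⊢-mono s p (init q)    = init (↭-trans (↭-sym p) q)
⊢-mono s p (clone q d) = clone (proj₂ (∈⇒↭∷ (s (↭∷⇒∈ q)))) (⊢-mono s (prep _ p) d)
⊢-mono s p (⊗R q d e)  = ⊗R (↭-trans (↭-sym p) q) (⊢-mono s refl d) (⊢-mono s refl e)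
⊢-mono s p (⊗L q d)    = ⊗L (↭-trans (↭-sym p) q) (⊢-mono s refl d)
⊢-mono s p (𝟏R q)      = 𝟏R (↭-trans (↭-sym p) q)
⊢-mono s p (𝟏L q d)    = 𝟏L (↭-trans (↭-sym p) q) (⊢-mono s refl d)
⊢-mono s p (&R d e)    = &R (⊢-mono s p d) (⊢-mono s p e)
⊢-mono s p (&L₁ q d)   = &L₁ (↭-trans (↭-sym p) q) (⊢-mono s refl d)
⊢-mono s p (&L₂ q d)   = &L₂ (↭-trans (↭-sym p) q) (⊢-mono s refl d)
⊢-mono s p ⊤R          = ⊤R
⊢-mono s p (⊸R d)      = ⊸R (⊢-mono s (prep _ p) d)
⊢-mono s p (⊸L q d e)  = ⊸L (↭-trans (↭-sym p) q) (⊢-mono s refl d) (⊢-mono s refl e)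
⊢-mono s p (!R q d)    = !R (↭-trans (↭-sym p) q) (⊢-mono s refl d)
⊢-mono s p (!L {A = A} q r d) =
  !L (↭-trans (↭-sym p) q) refl (⊢-mono (∷⁺ʳ A s ∘ ⊆-reflexive-↭ r) refl d)

⊢-weaken : ∀ {A Γ Δ C} → Γ ⨾ Δ ⊢ C → (A ∷ Γ) ⨾ Δ ⊢ C
⊢-weaken {A} {Γ} = ⊢-mono (xs⊆x∷xs Γ A) refl

!L-inv : ∀ {Γ Δ Δ₀ A C} → Γ ⨾ Δ ⊢ C → Δ ↭ (! A) ∷ Δ₀ → (A ∷ Γ) ⨾ Δ₀ ⊢ C
!L-inv (init q) p with ∈-resp-↭ q (↭∷⇒∈ p)
... | here ()
... | there ()
!L-inv (clone {A = B} q d) p = clone (prep-swap _ q) (!L-inv d (prep-swap B p))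
!L-inv (⊗R q d e) p with ++↭∷-cases (↭-trans (↭-sym q) p)
... | inj₁ (_ , r , s) = ⊗R s (!L-inv d r) (⊢-weaken e)
... | inj₂ (_ , r , s) = ⊗R s (⊢-weaken d) (!L-inv e r)
!L-inv (⊗L {A = B₁} {B = B₂} q d) p with ∷↭∷-cases (↭-trans (↭-sym q) p)
... | inj₁ (() , _)
... | inj₂ (_ , r , s) = ⊗L s (!L-inv d (prep-swap B₁ (prep-swap B₂ r)))
!L-inv (𝟏R q) p = ⊥-elim (¬x∷xs↭[] (↭-trans (↭-sym p) q))
!L-inv (𝟏L q d) p with ∷↭∷-cases (↭-trans (↭-sym q) p)
... | inj₁ (() , _)
... | inj₂ (_ , r , s) = 𝟏L s (!L-inv d r)
!L-inv (&R d e) p = &R (!L-inv d p) (!L-inv e p)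
!L-inv (&L₁ {A = B} q d) p with ∷↭∷-cases (↭-trans (↭-sym q) p)
... | inj₁ (() , _)
... | inj₂ (_ , r , s) = &L₁ s (!L-inv d (prep-swap B r))
!L-inv (&L₂ {B = B} q d) p with ∷↭∷-cases (↭-trans (↭-sym q) p)
... | inj₁ (() , _)
... | inj₂ (_ , r , s) = &L₂ s (!L-inv d (prep-swap B r))
!L-inv ⊤R p = ⊤R
!L-inv (⊸R {a = a} d) p = ⊸R (!L-inv d (prep-swap (atom a) p))
!L-inv (⊸L {B = B} q d e) p with ∷↭∷-cases (↭-trans (↭-sym q) p)
... | inj₁ (() , _)
... | inj₂ (_ , r , s) with ++↭∷-cases r
...   | inj₁ (_ , r₁ , s₁) = ⊸L (↭-trans s (prep _ s₁)) (!L-inv d r₁) (⊢-weaken e)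
...   | inj₂ (_ , r₂ , s₂) = ⊸L (↭-trans s (prep _ s₂)) (⊢-weaken d) (!L-inv e (prep-swap B r₂))
!L-inv (!R q d) p = ⊥-elim (¬x∷xs↭[] (↭-trans (↭-sym p) q))
!L-inv (!L {A = B} q r d) p with ∷↭∷-cases (↭-trans (↭-sym q) p)
... | inj₁ (refl , s) = ⊢-mono (⊆-reflexive-↭ r) s d
... | inj₂ (_ , r' , s) = !L s (prep-swap _ r) (!L-inv d r')

⨾-substˡ : ∀ {Γ₁ Γ₂ Δ C} → Γ₁ ≡ Γ₂ → Γ₁ ⨾ Δ ⊢ C → Γ₂ ⨾ Δ ⊢ C
⨾-substˡ {Δ = Δ} {C} = subst (λ Γ → Γ ⨾ Δ ⊢ C)

!L* : ∀ Γ₀ Γ Δ' Δ {C} → (Γ₀ ++ Γ) ⨾ (Δ' ++ Δ) ⊢ C → Γ₀ ⨾ (Δ' ++ !ctx Γ ++ Δ) ⊢ C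
!L* Γ₀ [] Δ' Δ d = ⨾-substˡ (++-identityʳ Γ₀) d
!L* Γ₀ (A ∷ Γ) Δ' Δ d =
  !L (shift (! A) Δ' (!ctx Γ ++ Δ)) (++-comm Γ₀ [ A ])
     (!L* (Γ₀ ++ [ A ]) Γ Δ' Δ (⨾-substˡ (sym (++-assoc Γ₀ [ A ] Γ)) d))

!L*-inv : ∀ Γ₀ Γ Δ' Δ {C} → Γ₀ ⨾ (Δ' ++ !ctx Γ ++ Δ) ⊢ C → (Γ₀ ++ Γ) ⨾ (Δ' ++ Δ) ⊢ C
!L*-inv Γ₀ [] Δ' Δ d = ⨾-substˡ (sym (++-identityʳ Γ₀)) d
!L*-inv Γ₀ (A ∷ Γ) Δ' Δ d =
  ⨾-substˡ (++-assoc Γ₀ [ A ] Γ)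
    (!L*-inv (Γ₀ ++ [ A ]) Γ Δ' Δ (⊢-mono (⊆-reflexive-↭ (++-comm [ A ] Γ₀)) refl
      (!L-inv d (shift (! A) Δ' (!ctx Γ ++ Δ)))))

lemma3 : ∀ (Γ Δ : Ctx) →
    ((Γ , Δ) ≼ₗ ([] , (!ctx Γ ++ Δ))) × (([] , (!ctx Γ ++ Δ)) ≼ₗ (Γ , Δ))
lemma3 Γ Δ =
  (λ Γ' Δ' C → !L* (Γ' ++ []) Γ Δ' Δ ∘ ⨾-substˡ (cong (_++ Γ) (sym (++-identityʳ Γ')))) ,
  (λ Γ' Δ' C → !L*-inv Γ' Γ Δ' Δ ∘ ⨾-substˡ (++-identityʳ Γ'))
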